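{- Each of the following four algebras on $\{0,1,2\}$ has exactly one ternary cyclic term operation. $\mathbf{T}_1^N=(\{0,1,2\};g_1)$, $\mathbf{T}_2^N=(\{0,1,2\};g_2)$, $\mathbf{T}_3^N=(\{0,1,2\};g_3)$, where each $g_i$ is a symmetric (invariant under all permutations of arguments) idempotent ternary operation determined as follows: - $g_1$: on $\{0,1\}$ it is the majority operation; on $\{0,2\}$ it is the ternary minimum with respect to $0\le 2$; $g_1(1,1,2)=1$, $g_1(1,2,2)=0$, $g_1(0,1,2)=0$. - $g_2$: on $\{0,1\}$ it is the minority operation $x+y+z \bmod 2$; on $\{0,2\}$ it is the ternary minimum with respect to $0\le 2$; $g_2(1,1,2)=0$, $g_2(1,2,2)=1$, $g_2(0,1,2)=1$. - $g_3$: on $\{0,1\}$ it is the majority operation; on $\{0,2\}$ it is the minority operation; $g_3(1,1,2)=2$, $g_3(1,2,2)=0$, $g_3(0,1,2)=2$. $\mathbf{T}_4^N=(\{0,1,2\};\wedge)$ is the meet-semilattice for the order in which $0\le 1$, $0\le 2$ and $1,2$ are incomparable.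
   Context: A ternary operation $f$ is cyclic if $f(x,y,z)=f(y,z,x)$ for all $x,y,z$. "Ternary cyclic term operation" means a ternary term operation of the algebra that is cyclic. The majority operation on a two-element set returns the value occurring at least twice; the minority operation returns the value occurring an odd number of times. -}

module Defs where

open import Data.Nat using (ℕ)
open import Data.Fin using (Fin; zero; suc)
open import Data.Product using (Σ; _×_; _,_)
open import Relation.Binary.PropositionalEquality using (_≡_)

A : Set
A = Fin 3

pattern ₀ = zero
pattern ₁ = suc zero
pattern ₂ = suc (suc zero)

record Algebra : Set where
  field
    arity : ℕ
    op    : (Fin arity → A) → A
open Algebra public

data Term (k n : ℕ) : Set where
  var : Fin n → Term k n
  app : (Fin k → Term k n) → Term k n

⟦_⟧ : {n : ℕ} (𝔸 : Algebra) → Term (arity 𝔸) n → (Fin n → A) → A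
⟦ 𝔸 ⟧ (var i) ρ = ρ i
⟦ 𝔸 ⟧ (app ts) ρ = op 𝔸 (λ j → ⟦ 𝔸 ⟧ (ts j) ρ)

ternary : (𝔸 : Algebra) → Term (arity 𝔸) 3 → A → A → A → A
ternary 𝔸 t x y z = ⟦ 𝔸 ⟧ t ρ
  where
  ρ : Fin 3 → A
  ρ ₀ = x
  ρ ₁ = y
  ρ ₂ = z

Cyclic : (A → A → A → A) → Set
Cyclic f = ∀ x y z → f x y z ≡ f y z x

ExactlyOneCyclicTermOp : Algebra → Set
ExactlyOneCyclicTermOp 𝔸 =
  Σ (Term (arity 𝔸) 3) λ t →
    Cyclic (ternary 𝔸 t) ×
    ((s : Term (arity 𝔸) 3) → Cyclic (ternary 𝔸 s) →
       ∀ x y z → ternary 𝔸 s x y z ≡ ternary 𝔸 t x y z)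

sym3 : (v001 v011 v002 v022 v112 v122 v012 : A) → A → A → A → A
sym3 _ _ _ _ _ _ _ ₀ ₀ ₀ = ₀
sym3 _ _ _ _ _ _ _ ₁ ₁ ₁ = ₁
sym3 _ _ _ _ _ _ _ ₂ ₂ ₂ = ₂
sym3 a _ _ _ _ _ _ ₀ ₀ ₁ = a
sym3 a _ _ _ _ _ _ ₀ ₁ ₀ = a
sym3 a _ _ _ _ _ _ ₁ ₀ ₀ = a
sym3 _ b _ _ _ _ _ ₀ ₁ ₁ = b
sym3 _ b _ _ _ _ _ ₁ ₀ ₁ = b
sym3 _ b _ _ _ _ _ ₁ ₁ ₀ = b
sym3 _ _ c _ _ _ _ ₀ ₀ ₂ = c
sym3 _ _ c _ _ _ _ ₀ ₂ ₀ = c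
sym3 _ _ c _ _ _ _ ₂ ₀ ₀ = c
sym3 _ _ _ d _ _ _ ₀ ₂ ₂ = d
sym3 _ _ _ d _ _ _ ₂ ₀ ₂ = d
sym3 _ _ _ d _ _ _ ₂ ₂ ₀ = d
sym3 _ _ _ _ e _ _ ₁ ₁ ₂ = e
sym3 _ _ _ _ e _ _ ₁ ₂ ₁ = e
sym3 _ _ _ _ e _ _ ₂ ₁ ₁ = e
sym3 _ _ _ _ _ f _ ₁ ₂ ₂ = f
sym3 _ _ _ _ _ f _ ₂ ₁ ₂ = f
sym3 _ _ _ _ _ f _ ₂ ₂ ₁ = f
sym3 _ _ _ _ _ _ g ₀ ₁ ₂ = g
sym3 _ _ _ _ _ _ g ₀ ₂ ₁ = g
sym3 _ _ _ _ _ _ g ₁ ₀ ₂ = g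
sym3 _ _ _ _ _ _ g ₁ ₂ ₀ = g
sym3 _ _ _ _ _ _ g ₂ ₀ ₁ = g
sym3 _ _ _ _ _ _ g ₂ ₁ ₀ = g

g₁ : A → A → A → A
g₁ = sym3 ₀ ₁ ₀ ₀ ₁ ₀ ₀

g₂ : A → A → A → A
g₂ = sym3 ₁ ₀ ₀ ₀ ₀ ₁ ₁

g₃ : A → A → A → A
g₃ = sym3 ₀ ₁ ₂ ₀ ₂ ₀ ₂

_∧_ : A → A → A
₁ ∧ ₁ = ₁
₂ ∧ ₂ = ₂
_ ∧ _ = ₀

ternaryAlg : (A → A → A → A) → Algebra
ternaryAlg g = record { arity = 3 ; op = λ v → g (v ₀) (v ₁) (v ₂) }

T₁ T₂ T₃ T₄ : Algebra
T₁ = ternaryAlg g₁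
T₂ = ternaryAlg g₂
T₃ = ternaryAlg g₃
T₄ = record { arity = 2 ; op = λ v → v ₀ ∧ v ₁ }

-- A ternary term operation f of an algebra 𝔸 preserves every relation
-- compatible with 𝔸. The three rotations of (x, y, z) are both the rows and
-- the columns of a circulant matrix, so applying f to them row by row shows:
-- if f is cyclic, then (v, v, v) with v = f(x, y, z) lies in the subpower of
-- 𝔸³ generated by those rotations. For each of the four algebras and each
-- (x, y, z) ∈ A³ this subpower has a single diagonal element, which is the
-- value of the claimed cyclic term there; the subpowers are computed and
-- checked by evaluation.
module Submission where

open import Defs
open import Data.Bool using (if_then_else_)
open import Data.Fin using (Fin; _≟_)
open import Data.Fin.Properties using (all?)
open import Data.List using (List; []; _∷_; _++_; length; cartesianProductWith; cartesianProduct; deduplicate)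
open import Data.List.Membership.Propositional.Properties using (∈-cartesianProductWith⁺; ∈-cartesianProduct⁺)
open import Data.List.Relation.Unary.All as All using (All; []; _∷_)
open import Data.Nat using (ℕ; zero; suc; _≡ᵇ_)
open import Data.Product using (_×_; _,_; uncurry)
open import Data.Product.Properties using (≡-dec)
open import Level using (0ℓ)
open import Relation.Binary.Definitions using (DecidableEquality)
open import Relation.Binary.PropositionalEquality using (_≡_; sym; trans; subst₂)
open import Relation.Nullary.Decidable using (Dec; True; toWitness; _×-dec_; _→-dec_)
open import Relation.Unary using (Pred)

A³ : Set
A³ = A × A × A

_≟³_ : DecidableEquality A³
_≟³_ = ≡-dec _≟_ (≡-dec _≟_ _≟_)

open import Data.List.Membership.DecPropositional _≟³_ using (_∈_; _∈?_)

_Preserves_ : ∀ {k} → ((Fin k → A) → A) → Pred A³ 0ℓ → Set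
o Preserves R = ∀ u v w → (∀ j → R (u j , v j , w j)) → R (o u , o v , o w)

module _ (𝔸 : Algebra) {R : Pred A³ 0ℓ} (op-preserves : op 𝔸 Preserves R) where

  ⟦⟧-preserves : ∀ {n} (s : Term (arity 𝔸) n) → ⟦ 𝔸 ⟧ s Preserves R
  ⟦⟧-preserves (var i)  u v w uvw∈R = uvw∈R i
  ⟦⟧-preserves (app ts) u v w uvw∈R =
    op-preserves _ _ _ λ j → ⟦⟧-preserves (ts j) u v w uvw∈R

  cyclic-diagonal : (s : Term (arity 𝔸) 3) → Cyclic (ternary 𝔸 s) → ∀ {x y z} →
    R (x , y , z) → R (y , z , x) → R (z , x , y) →
    let v = ternary 𝔸 s x y z in R (v , v , v)
  cyclic-diagonal s cyclic {x} {y} {z} r₀ r₁ r₂ =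
    subst₂ (λ b c → R (ternary 𝔸 s x y z , b , c))
      (sym (cyclic x y z)) (sym (trans (cyclic x y z) (cyclic y z x)))
      (⟦⟧-preserves s _ _ _ λ { ₀ → r₀ ; ₁ → r₁ ; ₂ → r₂ })

rotations : A → A → A → List A³
rotations x y z = (x , y , z) ∷ (y , z , x) ∷ (z , x , y) ∷ []

cyclic? : (f : A → A → A → A) → Dec (Cyclic f)
cyclic? f = all? λ x → all? λ y → all? λ z → f x y z ≟ f y z x

module Subpowers (𝔸 : Algebra) (images : List A³ → List A³)
  (images⁺ : ∀ {S} u v w → (∀ j → (u j , v j , w j) ∈ S) →
             (op 𝔸 u , op 𝔸 v , op 𝔸 w) ∈ images S) where

  Closed : List A³ → Set
  Closed S = All (_∈ S) (images S)

  closed⇒preserves : ∀ {S} → Closed S → op 𝔸 Preserves (_∈ S)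
  closed⇒preserves closed u v w uvw∈S = All.lookup closed (images⁺ u v w uvw∈S)

  saturate : ℕ → List A³ → List A³
  saturate zero    S = S
  saturate (suc n) S =
    let S′ = deduplicate _≟³_ (S ++ images S) in
    if length S′ ≡ᵇ length S then S else saturate n S′

  -- |A³| = 27 rounds always reach the fixpoint; closedness is checked anyway.
  generated : List A³ → List A³
  generated = saturate 27

  Pins : A → A → A → A → List A³ → Set
  Pins x y z v S = Closed S × All (_∈ S) (rotations x y z) × (∀ w → (w , w , w) ∈ S → w ≡ v)

  pins? : ∀ x y z v S → Dec (Pins x y z v S)
  pins? x y z v S =
    All.all? (_∈? S) (images S) ×-dec
    All.all? (_∈? S) (rotations x y z) ×-dec
    all? (λ w → (w , w , w) ∈? S →-dec w ≟ v)

  pinned : ∀ {x y z v} S → Pins x y z v S →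
           (s : Term (arity 𝔸) 3) → Cyclic (ternary 𝔸 s) → ternary 𝔸 s x y z ≡ v
  pinned S (closed , r₀ ∷ r₁ ∷ r₂ ∷ [] , diagonal) s cyclic =
    diagonal _ (cyclic-diagonal 𝔸 {R = _∈ S} (closed⇒preserves closed) s cyclic r₀ r₁ r₂)

  AllPinned : Term (arity 𝔸) 3 → Set
  AllPinned t = ∀ x y z → Pins x y z (ternary 𝔸 t x y z) (generated (rotations x y z))

  allPinned? : ∀ t → Dec (AllPinned t)
  allPinned? t = all? λ x → all? λ y → all? λ z →
    pins? x y z (ternary 𝔸 t x y z) (generated (rotations x y z))

  exactlyOneCyclic : (t : Term (arity 𝔸) 3) →
    {True (cyclic? (ternary 𝔸 t))} → {True (allPinned? t)} → ExactlyOneCyclicTermOp 𝔸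
  exactlyOneCyclic t {cyclic} {pins} =
    t , toWitness cyclic , λ s cyclic-s x y z → pinned _ (toWitness pins x y z) s cyclic-s

zipWith³ : (A → A → A → A) → A³ → A³ → A³ → A³
zipWith³ g (a , b , c) (a′ , b′ , c′) (a″ , b″ , c″) = g a a′ a″ , g b b′ b″ , g c c′ c″

images³ : (A → A → A → A) → List A³ → List A³
images³ g S = cartesianProductWith (λ p → uncurry (zipWith³ g p)) S (cartesianProduct S S)

images³⁺ : ∀ g {S} u v w → (∀ j → (u j , v j , w j) ∈ S) →
           (op (ternaryAlg g) u , op (ternaryAlg g) v , op (ternaryAlg g) w) ∈ images³ g S
images³⁺ g u v w uvw∈S = ∈-cartesianProductWith⁺ _ (uvw∈S ₀) (∈-cartesianProduct⁺ (uvw∈S ₁) (uvw∈S ₂))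

zipWith² : (A → A → A) → A³ → A³ → A³
zipWith² _·_ (a , b , c) (a′ , b′ , c′) = a · a′ , b · b′ , c · c′

images² : (A → A → A) → List A³ → List A³
images² _·_ S = cartesianProductWith (zipWith² _·_) S S

images²⁺ : ∀ _·_ {S} (u v w : Fin 2 → A) → (∀ j → (u j , v j , w j) ∈ S) →
           (u ₀ · u ₁ , v ₀ · v ₁ , w ₀ · w ₁) ∈ images² _·_ S
images²⁺ _ u v w uvw∈S = ∈-cartesianProductWith⁺ _ (uvw∈S ₀) (uvw∈S ₁)

module TernarySubpowers (g : A → A → A → A) = Subpowers (ternaryAlg g) (images³ g) (images³⁺ g)

_⊓_ : ∀ {n} → Term 2 n → Term 2 n → Term 2 n
s ⊓ t = app λ { ₀ → s ; ₁ → t }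

meet³ : Term 2 3
meet³ = var ₀ ⊓ (var ₁ ⊓ var ₂)

lemma27 : ExactlyOneCyclicTermOp T₁ × ExactlyOneCyclicTermOp T₂ × ExactlyOneCyclicTermOp T₃ × ExactlyOneCyclicTermOp T₄
lemma27 =
  TernarySubpowers.exactlyOneCyclic g₁ (app var) ,
  TernarySubpowers.exactlyOneCyclic g₂ (app var) ,
  TernarySubpowers.exactlyOneCyclic g₃ (app var) ,
  Subpowers.exactlyOneCyclic T₄ (images² _∧_) (images²⁺ _∧_) meet³
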